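{- Let $D$ be a non-trivial $(v,b,r,k,\lambda)$-design (i.e. $k<v$) with associated split graph $G_D$, whose clique of point-vertices has size $c=v$ and whose stable set of block-vertices has size $s=b$. If $G_D$ has diameter $3$, then $D$ is non-symmetric (i.e. $b\neq v$) and $s>c$.
   Context: A $(v,b,r,k,\lambda)$-design over a $v$-element set $E$ is a family $D$ (possibly with repeated blocks) of $b$ $k$-subsets of $E$ such that every two distinct elements of $E$ lie together in exactly $\lambda>0$ blocks; each element lies in exactly $r$ blocks. It is symmetric if $b=v$. The associated split graph $G_D$ has a vertex for each point and for each block (with multiplicity); point-vertices are pairwise adjacent, a point-vertex is adjacent to a block-vertex iff the point lies in the block, and block-vertices are pairwise non-adjacent. -}

module Defs where

open import Data.Nat using (ℕ; zero; suc; _≤_; _<_; _∸_)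
open import Data.Fin using (Fin)
open import Data.Fin.Subset using (Subset; ∣_∣; _∈_)
open import Data.Vec using (tabulate; lookup)
open import Data.Bool using (_∧_)
open import Data.Sum using (_⊎_; inj₁; inj₂)
open import Data.Product using (Σ; _×_; ∃; ∃-syntax)
open import Data.Empty using (⊥)
open import Relation.Nullary using (¬_)
open import Relation.Binary.PropositionalEquality using (_≡_; _≢_)

-- A family of b blocks (with possible repetition) over the point set Fin v.
Blocks : ℕ → ℕ → Set
Blocks v b = Fin b → Subset v

pairCount : ∀ {v b} → Blocks v b → Fin v → Fin v → ℕ
pairCount B x y = ∣ tabulate (λ i → lookup (B i) x ∧ lookup (B i) y) ∣

repCount : ∀ {v b} → Blocks v b → Fin v → ℕ
repCount B x = ∣ tabulate (λ i → lookup (B i) x) ∣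

record IsDesign (v b r k lam : ℕ) (B : Blocks v b) : Set where
  field
    blockSize : ∀ i → ∣ B i ∣ ≡ k
    replication : ∀ x → repCount B x ≡ r
    balance : ∀ x y → x ≢ y → pairCount B x y ≡ lam
    lam-pos : 0 < lam

-- Associated split graph G_D: vertices are points (inj₁) and blocks (inj₂).
Vertex : ℕ → ℕ → Set
Vertex v b = Fin v ⊎ Fin b

data Adj {v b} (B : Blocks v b) : Vertex v b → Vertex v b → Set where
  pp : ∀ {x y} → x ≢ y → Adj B (inj₁ x) (inj₁ y)
  pb : ∀ {x i} → x ∈ B i → Adj B (inj₁ x) (inj₂ i)
  bp : ∀ {x i} → x ∈ B i → Adj B (inj₂ i) (inj₁ x)

data Walk {V : Set} (E : V → V → Set) : V → V → ℕ → Set where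
  here : ∀ {x} → Walk E x x zero
  step : ∀ {x y z n} → E x y → Walk E y z n → Walk E x z (suc n)

DistLe : {V : Set} → (V → V → Set) → ℕ → V → V → Set
DistLe E n x y = ∃[ m ] (m ≤ n × Walk E x y m)

HasDiameter : {V : Set} → (V → V → Set) → ℕ → Set
HasDiameter {V} E d =
  (∀ x y → DistLe E d x y) × (∃[ x ] ∃[ y ] ¬ DistLe E (d ∸ 1) x y)

module Submission where

-- A pair of vertices of G_D at distance 3 must be two disjoint blocks B, B′: points are pairwise
-- adjacent, and a nonempty block is within distance 2 of every point. Let x_C = |B ∩ C| for the
-- n = b − 1 blocks C ≠ B. Double counting gives S₁ = Σ x_C = k(r − 1) and
-- S₂ = Σ x_C² = k(r − 1) + k(k − 1)(λ − 1), and since x_B′ = 0, Cauchy–Schwarz over the remaining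
-- n − 1 blocks gives S₁² ≤ (n − 1) S₂ < n S₂. With bk = vr and r(k − 1) = λ(v − 1) one has the
-- identity k(v − 1)(n S₂ − S₁²) = kr(r − k)(v − k)², so r > k, and then b = vr/k > v.

open import Defs
open import Relation.Binary.PropositionalEquality

module ℤ-identities where
  open import Data.Integer using (ℤ; _+_; _-_; _*_; 1ℤ)
  open import Data.Integer.Tactic.RingSolver using (solve-∀)
  open ≡-Reasoning

  isolate : ∀ {a x c : ℤ} → a + x ≡ c → x ≡ c - a
  isolate {a} {x} refl = begin
    x ≡⟨ shift a x ⟩ a + x - a ∎
    where
    shift : ∀ a x → x ≡ a + x - a
    shift = solve-∀

  fisher-defect : ∀ v k r l n S₁ S₂ →
    k + n * k ≡ v * r → r * k + l ≡ l * v + r →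
    k + S₁ ≡ r * k → k * k + l * k + S₂ ≡ l * (k * k) + r * k →
    k * (v - 1ℤ) * (n * S₂ - S₁ * S₁) ≡ k * r * (r - k) * ((v - k) * (v - k))
  fisher-defect v k r l n S₁ S₂ double-count pair-count moment₁ moment₂
    with refl ← isolate {k} {S₁} moment₁ | refl ← isolate {k * k + l * k} {S₂} moment₂ = begin
    k * w * (n * S₂ - S₁ * S₁)                        ≡⟨ regroup-by-n*k v k r l n ⟩
    n * k * w·S₂ (l * w) - k * w * (S₁ * S₁)          ≡⟨ cong₂ (λ a c → a * w·S₂ c - k * w * (S₁ * S₁))
                                                               (isolate {k} {n * k} double-count) λ⟨v-1⟩ ⟩
    (v * r - k) * w·S₂ (r * (k - 1ℤ)) - k * w * (S₁ * S₁) ≡⟨ defect-polynomial v k r ⟩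
    k * r * (r - k) * ((v - k) * (v - k))             ∎
    where
    w : ℤ
    w = v - 1ℤ
    -- (v − 1) S₂, with λ(v − 1) written as c
    w·S₂ : ℤ → ℤ
    w·S₂ c = k * w * (r - 1ℤ) + k * (k - 1ℤ) * (c - w)
    λ⟨v-1⟩ : l * w ≡ r * (k - 1ℤ)
    λ⟨v-1⟩ = begin
      l * (v - 1ℤ)            ≡⟨ expand₁ v r l ⟩
      l * v + r - (r + l)     ≡⟨ cong (_- (r + l)) pair-count ⟨
      r * k + l - (r + l)     ≡⟨ expand₂ k r l ⟩
      r * (k - 1ℤ)            ∎
      where
      expand₁ : ∀ v r l → l * (v - 1ℤ) ≡ l * v + r - (r + l)
      expand₁ = solve-∀
      expand₂ : ∀ k r l → r * k + l - (r + l) ≡ r * (k - 1ℤ)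
      expand₂ = solve-∀
    regroup-by-n*k : ∀ v k r l n →
      let w = v - 1ℤ; S₁ = r * k - k; S₂ = l * (k * k) + r * k - (k * k + l * k) in
      k * w * (n * S₂ - S₁ * S₁) ≡
      n * k * (k * w * (r - 1ℤ) + k * (k - 1ℤ) * (l * w - w)) - k * w * (S₁ * S₁)
    regroup-by-n*k = solve-∀
    defect-polynomial : ∀ v k r → let w = v - 1ℤ; S₁ = r * k - k in
      (v * r - k) * (k * w * (r - 1ℤ) + k * (k - 1ℤ) * (r * (k - 1ℤ) - w)) - k * w * (S₁ * S₁) ≡
      k * r * (r - k) * ((v - k) * (v - k))
    defect-polynomial = solve-∀

  fisher-defect-when-r≤k : ∀ r d e l n S₁ S₂ → let k = r + d; v = 1ℤ + k + e in
    k + n * k ≡ v * r → r * k + l ≡ l * v + r →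
    k + S₁ ≡ r * k → k * k + l * k + S₂ ≡ l * (k * k) + r * k →
    k * (k + e) * (n * S₂) + k * r * d * ((1ℤ + e) * (1ℤ + e)) ≡ k * (k + e) * (S₁ * S₁)
  fisher-defect-when-r≤k r d e l n S₁ S₂ double-count pair-count moment₁ moment₂ = begin
    k * (k + e) * (n * S₂) + k * r * d * ((1ℤ + e) * (1ℤ + e))
      ≡⟨ split r d e n S₁ S₂ ⟩
    k * (v - 1ℤ) * (n * S₂ - S₁ * S₁) + k * r * d * ((1ℤ + e) * (1ℤ + e)) + k * (k + e) * (S₁ * S₁)
      ≡⟨ cong (λ t → t + k * r * d * ((1ℤ + e) * (1ℤ + e)) + k * (k + e) * (S₁ * S₁))
              (fisher-defect v k r l n S₁ S₂ double-count pair-count moment₁ moment₂) ⟩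
    k * r * (r - k) * ((v - k) * (v - k)) + k * r * d * ((1ℤ + e) * (1ℤ + e)) + k * (k + e) * (S₁ * S₁)
      ≡⟨ cancel r d e S₁ ⟩
    k * (k + e) * (S₁ * S₁) ∎
    where
    k v : ℤ
    k = r + d
    v = 1ℤ + k + e
    split : ∀ r d e n S₁ S₂ → let k = r + d; v = 1ℤ + k + e in
      k * (k + e) * (n * S₂) + k * r * d * ((1ℤ + e) * (1ℤ + e)) ≡
      k * (v - 1ℤ) * (n * S₂ - S₁ * S₁) + k * r * d * ((1ℤ + e) * (1ℤ + e)) + k * (k + e) * (S₁ * S₁)
    split = solve-∀
    cancel : ∀ r d e S₁ → let k = r + d; v = 1ℤ + k + e in
      k * r * (r - k) * ((v - k) * (v - k)) + k * r * d * ((1ℤ + e) * (1ℤ + e)) + k * (k + e) * (S₁ * S₁) ≡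
      k * (k + e) * (S₁ * S₁)
    cancel = solve-∀

open import Data.Nat using (ℕ; zero; suc; _+_; _*_; _≤_; _<_; _≤?_; z≤n; s≤s; >-nonZero)
import Data.Integer as ℤ
open import Data.Integer.Properties using (pos-*; +-injective)
open import Relation.Nullary using (¬_; yes; no; contradiction)
open import Data.Nat.Properties
open import Data.Nat.Tactic.RingSolver using (solve-∀)
open import Data.Fin as Fin using (Fin; punchIn; punchOut)
open import Data.Fin.Properties using (punchInᵢ≢i; punchIn-punchOut)
open import Data.Vec.Functional using (removeAt)
open import Data.Bool using (Bool; true; false; _∧_)
open import Data.Bool.Properties using (∧-idem)
open import Data.Vec using (_∷_; []; lookup; tabulate)
open import Data.Vec.Properties using (lookup∘tabulate; lookup-zipWith; lookup⇒[]=; []=⇒lookup)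
open import Data.Fin.Subset using (Subset; ∣_∣; _∩_; Nonempty; Empty)
open import Data.Fin.Subset.Properties using (x∈p∩q⁺; x∈p∩q⁻; nonempty?)
open import Algebra.Properties.CommutativeSemigroup +-commutativeSemigroup using (xy∙z≈xz∙y)
open import Data.Sum using (_⊎_; inj₁; inj₂; [_,_]′)
open import Data.Product using (_×_; _,_; ∃-syntax)
open import Function using (_∘_)
open import Algebra.Properties.Semiring.Sum +-*-semiring
  using ( sum; sum-syntax; sum-cong-≗; sum-remove; sum-replicate-zero
        ; ∑-comm; ∑-distrib-+; *-distribˡ-sum; *-distribʳ-sum )

sum-const : ∀ n c → ∑[ i < n ] c ≡ n * c
sum-const zero    c = refl
sum-const (suc n) c = cong (c +_) (sum-const n c)

term≤sum : ∀ {n} (f : Fin n → ℕ) i → f i ≤ sum f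
term≤sum f Fin.zero    = m≤m+n (f Fin.zero) _
term≤sum f (Fin.suc i) = ≤-trans (term≤sum (f ∘ Fin.suc) i) (m≤n+m _ (f Fin.zero))

2mn≤m²+n² : ∀ m n → 2 * (m * n) ≤ m * m + n * n
2mn≤m²+n² m n = [ ordered , flipped ]′ (≤-total m n)
  where
  ordered : ∀ {a b} → a ≤ b → 2 * (a * b) ≤ a * a + b * b
  ordered {a} a≤b with d , refl ← m≤n⇒∃[o]m+o≡n a≤b = begin
    2 * (a * (a + d))          ≤⟨ m≤m+n _ (d * d) ⟩
    2 * (a * (a + d)) + d * d  ≡⟨ square-of-sum a d ⟩
    a * a + (a + d) * (a + d)  ∎
    where
    open ≤-Reasoning
    square-of-sum : ∀ a d → 2 * (a * (a + d)) + d * d ≡ a * a + (a + d) * (a + d)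
    square-of-sum = solve-∀
  flipped : n ≤ m → 2 * (m * n) ≤ m * m + n * n
  flipped n≤m = subst₂ _≤_ (cong (2 *_) (*-comm n m)) (+-comm (n * n) (m * m)) (ordered n≤m)

cross-term≤ : ∀ {n} a (y : Fin n → ℕ) →
  2 * (a * sum y) ≤ n * (a * a) + ∑[ i < n ] (y i * y i)
cross-term≤ {zero}  a y = ≤-reflexive (cong (2 *_) (*-zeroʳ a))
cross-term≤ {suc n} a y = begin
  2 * (a * (y₀ + T))                      ≡⟨ expand a y₀ T ⟩
  2 * (a * y₀) + 2 * (a * T)              ≤⟨ +-mono-≤ (2mn≤m²+n² a y₀) (cross-term≤ a (y ∘ Fin.suc)) ⟩
  a * a + y₀ * y₀ + (n * (a * a) + Q)     ≡⟨ regroup a y₀ n Q ⟩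
  a * a + n * (a * a) + (y₀ * y₀ + Q)     ∎
  where
  open ≤-Reasoning
  y₀ T Q : ℕ
  y₀ = y Fin.zero
  T = sum (y ∘ Fin.suc)
  Q = ∑[ i < n ] (y (Fin.suc i) * y (Fin.suc i))
  expand : ∀ a y₀ T → 2 * (a * (y₀ + T)) ≡ 2 * (a * y₀) + 2 * (a * T)
  expand = solve-∀
  regroup : ∀ a y₀ n Q → a * a + y₀ * y₀ + (n * (a * a) + Q) ≡ a * a + n * (a * a) + (y₀ * y₀ + Q)
  regroup = solve-∀

cauchy-schwarz : ∀ {n} (y : Fin n → ℕ) → sum y * sum y ≤ n * ∑[ i < n ] (y i * y i)
cauchy-schwarz {zero}  y = z≤n
cauchy-schwarz {suc n} y = begin
  (y₀ + T) * (y₀ + T)                            ≡⟨ expand y₀ T ⟩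
  y₀ * y₀ + 2 * (y₀ * T) + T * T                 ≤⟨ +-mono-≤ (+-monoʳ-≤ (y₀ * y₀) (cross-term≤ y₀ (y ∘ Fin.suc)))
                                                              (cauchy-schwarz (y ∘ Fin.suc)) ⟩
  y₀ * y₀ + (n * (y₀ * y₀) + Q) + n * Q          ≡⟨ regroup y₀ n Q ⟩
  (y₀ * y₀ + Q) + n * (y₀ * y₀ + Q)              ∎
  where
  open ≤-Reasoning
  y₀ T Q : ℕ
  y₀ = y Fin.zero
  T = sum (y ∘ Fin.suc)
  Q = ∑[ i < n ] (y (Fin.suc i) * y (Fin.suc i))
  expand : ∀ y₀ T → (y₀ + T) * (y₀ + T) ≡ y₀ * y₀ + 2 * (y₀ * T) + T * T
  expand = solve-∀
  regroup : ∀ y₀ n Q → y₀ * y₀ + (n * (y₀ * y₀) + Q) + n * Q ≡ (y₀ * y₀ + Q) + n * (y₀ * y₀ + Q)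
  regroup = solve-∀

cauchy-schwarz-with-zero : ∀ {n} (y : Fin n → ℕ) (p : Fin n) → y p ≡ 0 →
  sum y * sum y + ∑[ i < n ] (y i * y i) ≤ n * ∑[ i < n ] (y i * y i)
cauchy-schwarz-with-zero {suc n} y p yp≡0
  rewrite sum-remove {i = p} y | sum-remove {i = p} (λ i → y i * y i) | yp≡0 = begin
  S * S + Q   ≤⟨ +-monoˡ-≤ Q (cauchy-schwarz (removeAt y p)) ⟩
  n * Q + Q   ≡⟨ +-comm (n * Q) Q ⟩
  suc n * Q   ∎
  where
  open ≤-Reasoning
  S Q : ℕ
  S = sum (removeAt y p)
  Q = ∑[ i < n ] (removeAt y p i * removeAt y p i)

sum-*-constantExcept : ∀ {n} (g h : Fin n → ℕ) (x : Fin n) {r lam : ℕ} →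
  h x ≡ r → (∀ y → y ≢ x → h y ≡ lam) →
  ∑[ y < n ] (g y * h y) + lam * g x ≡ lam * sum g + r * g x
sum-*-constantExcept {suc n} g h x {r} {lam} hx≡r hy≡lam = begin
  sum (λ y → g y * h y) + lam * g x
    ≡⟨ cong (_+ lam * g x) (sum-remove {i = x} (λ y → g y * h y)) ⟩
  g x * h x + ∑[ j < n ] (g (punchIn x j) * h (punchIn x j)) + lam * g x
    ≡⟨ cong₂ (λ a s → g x * a + s + lam * g x) hx≡r
         (sum-cong-≗ (λ j → cong (g (punchIn x j) *_) (hy≡lam (punchIn x j) (punchInᵢ≢i x j)))) ⟩
  g x * r + ∑[ j < n ] (g (punchIn x j) * lam) + lam * g x
    ≡⟨ cong (λ s → g x * r + s + lam * g x) (*-distribʳ-sum lam (removeAt g x)) ⟨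
  g x * r + sum (removeAt g x) * lam + lam * g x
    ≡⟨ regroup (g x) r (sum (removeAt g x)) lam ⟩
  lam * (g x + sum (removeAt g x)) + r * g x
    ≡⟨ cong (λ s → lam * s + r * g x) (sum-remove g) ⟨
  lam * sum g + r * g x ∎
  where
  open ≡-Reasoning
  regroup : ∀ a r s lam → a * r + s * lam + lam * a ≡ lam * (a + s) + r * a
  regroup = solve-∀

sum-*-sum : ∀ {m n} (f : Fin m → ℕ) (g : Fin n → ℕ) →
  sum f * sum g ≡ ∑[ i < m ] ∑[ j < n ] (f i * g j)
sum-*-sum f g = begin
  sum f * sum g                       ≡⟨ *-distribʳ-sum (sum g) f ⟩
  ∑[ i < _ ] (f i * sum g)            ≡⟨ sum-cong-≗ (λ i → *-distribˡ-sum (f i) g) ⟩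
  ∑[ i < _ ] ∑[ j < _ ] (f i * g j)   ∎
  where open ≡-Reasoning

module Moments {v b r lam : ℕ} (N : Fin b → Fin v → ℕ)
  (column-sum : ∀ x → ∑[ C < b ] N C x ≡ r)
  (self-concurrence : ∀ x → ∑[ C < b ] (N C x * N C x) ≡ r)
  (concurrence : ∀ x y → y ≢ x → ∑[ C < b ] (N C x * N C y) ≡ lam) where

  open ≡-Reasoning

  weight : (Fin v → ℕ) → Fin b → ℕ
  weight g C = ∑[ x < v ] (g x * N C x)

  first-moment : ∀ g → ∑[ C < b ] weight g C ≡ r * sum g
  first-moment g = begin
    ∑[ C < b ] ∑[ x < v ] (g x * N C x)   ≡⟨ ∑-comm (λ C x → g x * N C x) ⟩
    ∑[ x < v ] ∑[ C < b ] (g x * N C x)   ≡⟨ sum-cong-≗ (λ x → *-distribˡ-sum (g x) (λ C → N C x)) ⟨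
    ∑[ x < v ] (g x * ∑[ C < b ] N C x)   ≡⟨ sum-cong-≗ (λ x → cong (g x *_) (column-sum x)) ⟩
    ∑[ x < v ] (g x * r)                  ≡⟨ *-distribʳ-sum r g ⟨
    sum g * r                             ≡⟨ *-comm (sum g) r ⟩
    r * sum g                             ∎

  ∑-weight-*-weight : ∀ g h → ∑[ C < b ] (weight g C * weight h C) ≡
    ∑[ x < v ] (g x * ∑[ y < v ] (h y * ∑[ C < b ] (N C x * N C y)))
  ∑-weight-*-weight g h = begin
    ∑[ C < b ] (weight g C * weight h C)
      ≡⟨ sum-cong-≗ (λ C → sum-*-sum (λ x → g x * N C x) (λ y → h y * N C y)) ⟩
    ∑[ C < b ] ∑[ x < v ] ∑[ y < v ] (g x * N C x * (h y * N C y))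
      ≡⟨ ∑-comm (λ C x → ∑[ y < v ] (g x * N C x * (h y * N C y))) ⟩
    ∑[ x < v ] ∑[ C < b ] ∑[ y < v ] (g x * N C x * (h y * N C y))
      ≡⟨ sum-cong-≗ (λ x → ∑-comm (λ C y → g x * N C x * (h y * N C y))) ⟩
    ∑[ x < v ] ∑[ y < v ] ∑[ C < b ] (g x * N C x * (h y * N C y))
      ≡⟨ sum-cong-≗ (λ x → sum-cong-≗ (λ y → sum-cong-≗ (λ C → regroup (g x) (h y) (N C x) (N C y)))) ⟩
    ∑[ x < v ] ∑[ y < v ] ∑[ C < b ] (g x * (h y * (N C x * N C y)))
      ≡⟨ sum-cong-≗ (λ x → sum-cong-≗ (λ y →
           trans (cong (g x *_) (*-distribˡ-sum (h y) (λ C → N C x * N C y)))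
                 (*-distribˡ-sum (g x) (λ C → h y * (N C x * N C y))))) ⟨
    ∑[ x < v ] ∑[ y < v ] (g x * (h y * ∑[ C < b ] (N C x * N C y)))
      ≡⟨ sum-cong-≗ (λ x → *-distribˡ-sum (g x) (λ y → h y * ∑[ C < b ] (N C x * N C y))) ⟨
    ∑[ x < v ] (g x * ∑[ y < v ] (h y * ∑[ C < b ] (N C x * N C y))) ∎
    where
    regroup : ∀ a c m n → a * m * (c * n) ≡ a * (c * (m * n))
    regroup = solve-∀

  second-moment : ∀ g h →
    ∑[ C < b ] (weight g C * weight h C) + lam * ∑[ x < v ] (g x * h x) ≡
    lam * (sum g * sum h) + r * ∑[ x < v ] (g x * h x)
  second-moment g h = begin
    ∑[ C < b ] (weight g C * weight h C) + lam * ∑[ x < v ] (g x * h x)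
      ≡⟨ cong₂ _+_ (∑-weight-*-weight g h) (*-distribˡ-sum lam (λ x → g x * h x)) ⟩
    ∑[ x < v ] (g x * I x) + ∑[ x < v ] (lam * (g x * h x))
      ≡⟨ ∑-distrib-+ (λ x → g x * I x) (λ x → lam * (g x * h x)) ⟨
    ∑[ x < v ] (g x * I x + lam * (g x * h x))
      ≡⟨ sum-cong-≗ (λ x → trans (factor (g x) (I x) (h x) lam) (cong (g x *_) (I-balanced x))) ⟩
    ∑[ x < v ] (g x * (lam * sum h + r * h x))
      ≡⟨ sum-cong-≗ (λ x → expand (g x) (sum h) (h x) lam r) ⟩
    ∑[ x < v ] (lam * sum h * g x + r * (g x * h x))
      ≡⟨ ∑-distrib-+ (λ x → lam * sum h * g x) (λ x → r * (g x * h x)) ⟩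
    ∑[ x < v ] (lam * sum h * g x) + ∑[ x < v ] (r * (g x * h x))
      ≡⟨ cong₂ _+_ (*-distribˡ-sum (lam * sum h) g) (*-distribˡ-sum r (λ x → g x * h x)) ⟨
    lam * sum h * sum g + r * ∑[ x < v ] (g x * h x)
      ≡⟨ cong (_+ r * ∑[ x < v ] (g x * h x)) (reorder lam (sum h) (sum g)) ⟩
    lam * (sum g * sum h) + r * ∑[ x < v ] (g x * h x) ∎
    where
    I : Fin v → ℕ
    I x = ∑[ y < v ] (h y * ∑[ C < b ] (N C x * N C y))
    I-balanced : ∀ x → I x + lam * h x ≡ lam * sum h + r * h x
    I-balanced x = sum-*-constantExcept h (λ y → ∑[ C < b ] (N C x * N C y)) x
             (self-concurrence x) (concurrence x)
    factor : ∀ a i c l → a * i + l * (a * c) ≡ a * (i + l * c)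
    factor = solve-∀
    expand : ∀ a s c l r → a * (l * s + r * c) ≡ l * s * a + r * (a * c)
    expand = solve-∀
    reorder : ∀ l s t → l * s * t ≡ l * (t * s)
    reorder = solve-∀

indicator : Bool → ℕ
indicator true  = 1
indicator false = 0

indicator-∧ : ∀ a c → indicator (a ∧ c) ≡ indicator a * indicator c
indicator-∧ true  c = sym (+-identityʳ (indicator c))
indicator-∧ false c = refl

indicator-idem : ∀ a → indicator a * indicator a ≡ indicator a
indicator-idem a = trans (sym (indicator-∧ a a)) (cong indicator (∧-idem a))

∣p∣≡∑indicator : ∀ {n} (p : Subset n) → ∣ p ∣ ≡ ∑[ x < n ] indicator (lookup p x)
∣p∣≡∑indicator []          = refl
∣p∣≡∑indicator (true  ∷ p) = cong suc (∣p∣≡∑indicator p)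
∣p∣≡∑indicator (false ∷ p) = ∣p∣≡∑indicator p

∣tabulate∣≡∑indicator : ∀ {n} (f : Fin n → Bool) → ∣ tabulate f ∣ ≡ ∑[ x < n ] indicator (f x)
∣tabulate∣≡∑indicator f =
  trans (∣p∣≡∑indicator (tabulate f)) (sum-cong-≗ (cong indicator ∘ lookup∘tabulate f))

Empty⇒indicator≡0 : ∀ {n} {p : Subset n} → Empty p → ∀ x → indicator (lookup p x) ≡ 0
Empty⇒indicator≡0 {p = p} p=∅ x with lookup p x in px
... | true  = contradiction (x , lookup⇒[]= x p px) p=∅
... | false = refl

incidence : ∀ {v b} → Blocks v b → Fin b → Fin v → ℕ
incidence B C x = indicator (lookup (B C) x)

module DesignCounting {v b r k lam} {B : Blocks v b} (D : IsDesign v b r k lam B) where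

  open IsDesign D
  open ≡-Reasoning

  row-sum : ∀ C → sum (incidence B C) ≡ k
  row-sum C = trans (sym (∣p∣≡∑indicator (B C))) (blockSize C)

  column-sum : ∀ x → ∑[ C < b ] incidence B C x ≡ r
  column-sum x = trans (sym (∣tabulate∣≡∑indicator (λ C → lookup (B C) x))) (replication x)

  pair-sum : ∀ x y → ∑[ C < b ] (incidence B C x * incidence B C y) ≡ pairCount B x y
  pair-sum x y = begin
    ∑[ C < b ] (incidence B C x * incidence B C y)
      ≡⟨ sum-cong-≗ (λ C → indicator-∧ (lookup (B C) x) (lookup (B C) y)) ⟨
    ∑[ C < b ] indicator (lookup (B C) x ∧ lookup (B C) y)
      ≡⟨ ∣tabulate∣≡∑indicator (λ C → lookup (B C) x ∧ lookup (B C) y) ⟨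
    pairCount B x y ∎

  self-concurrence : ∀ x → ∑[ C < b ] (incidence B C x * incidence B C x) ≡ r
  self-concurrence x =
    trans (sum-cong-≗ (λ C → indicator-idem (lookup (B C) x))) (column-sum x)

  concurrence : ∀ x y → y ≢ x → ∑[ C < b ] (incidence B C x * incidence B C y) ≡ lam
  concurrence x y y≢x = trans (pair-sum x y) (balance x y (y≢x ∘ sym))

  open Moments (incidence B) column-sum self-concurrence concurrence public

  b*k≡v*r : b * k ≡ v * r
  b*k≡v*r = begin
    b * k                                ≡⟨ sum-const b k ⟨
    ∑[ C < b ] k                         ≡⟨ sum-cong-≗ row-sum ⟨
    ∑[ C < b ] ∑[ x < v ] incidence B C x  ≡⟨ ∑-comm (incidence B) ⟩
    ∑[ x < v ] ∑[ C < b ] incidence B C x  ≡⟨ sum-cong-≗ column-sum ⟩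
    ∑[ x < v ] r                         ≡⟨ sum-const v r ⟩
    v * r                                ∎

fisher-defect-ℕ : ∀ {r d e n lam S₁ S₂} → let k = r + d; v = suc k + e in
  k + n * k ≡ v * r → r * k + lam ≡ lam * v + r →
  k + S₁ ≡ r * k → k * k + lam * k + S₂ ≡ lam * (k * k) + r * k →
  k * (k + e) * (n * S₂) + k * r * d * (suc e * suc e) ≡ k * (k + e) * (S₁ * S₁)
fisher-defect-ℕ {r} {d} {e} {n} {lam} {S₁} {S₂} double-count pair-count moment₁ moment₂ = +-injective (begin
  ℤ.+ (k * (k + e) * (n * S₂) + k * r * d * (suc e * suc e))
    ≡⟨ cong₂ ℤ._+_ (pos-*-* k (k + e) n S₂)
         (trans (pos-*-* (k * r) d (suc e) (suc e))
                (cong (λ t → t ℤ.* ℤ.+ d ℤ.* (ℤ.+ suc e ℤ.* ℤ.+ suc e)) (pos-* k r))) ⟩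
  _ ≡⟨ ℤ-identities.fisher-defect-when-r≤k (ℤ.+ r) (ℤ.+ d) (ℤ.+ e) (ℤ.+ lam) (ℤ.+ n) (ℤ.+ S₁) (ℤ.+ S₂)
         double-countℤ pair-countℤ moment₁ℤ moment₂ℤ ⟩
  _ ≡⟨ pos-*-* k (k + e) S₁ S₁ ⟨
  ℤ.+ (k * (k + e) * (S₁ * S₁)) ∎)
  where
  open ≡-Reasoning
  k v : ℕ
  k = r + d
  v = suc k + e
  pos-*-* : ∀ a b c d → ℤ.+ (a * b * (c * d)) ≡ ℤ.+ a ℤ.* ℤ.+ b ℤ.* (ℤ.+ c ℤ.* ℤ.+ d)
  pos-*-* a b c d = trans (pos-* (a * b) (c * d)) (cong₂ ℤ._*_ (pos-* a b) (pos-* c d))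
  double-countℤ : ℤ.+ k ℤ.+ ℤ.+ n ℤ.* ℤ.+ k ≡ ℤ.+ v ℤ.* ℤ.+ r
  double-countℤ = trans (cong (λ t → ℤ.+ k ℤ.+ t) (sym (pos-* n k)))
    (trans (cong ℤ.+_ double-count) (pos-* v r))
  pair-countℤ : ℤ.+ r ℤ.* ℤ.+ k ℤ.+ ℤ.+ lam ≡ ℤ.+ lam ℤ.* ℤ.+ v ℤ.+ ℤ.+ r
  pair-countℤ = trans (cong (λ t → t ℤ.+ ℤ.+ lam) (sym (pos-* r k)))
    (trans (cong ℤ.+_ pair-count) (cong (λ t → t ℤ.+ ℤ.+ r) (pos-* lam v)))
  moment₁ℤ : ℤ.+ k ℤ.+ ℤ.+ S₁ ≡ ℤ.+ r ℤ.* ℤ.+ k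
  moment₁ℤ = trans (cong ℤ.+_ moment₁) (pos-* r k)
  moment₂ℤ : ℤ.+ k ℤ.* ℤ.+ k ℤ.+ ℤ.+ lam ℤ.* ℤ.+ k ℤ.+ ℤ.+ S₂ ≡
             ℤ.+ lam ℤ.* (ℤ.+ k ℤ.* ℤ.+ k) ℤ.+ ℤ.+ r ℤ.* ℤ.+ k
  moment₂ℤ = trans (cong₂ (λ a c → a ℤ.+ c ℤ.+ ℤ.+ S₂) (sym (pos-* k k)) (sym (pos-* lam k)))
    (trans (cong ℤ.+_ moment₂)
      (cong₂ ℤ._+_ (trans (pos-* lam (k * k)) (cong (λ t → ℤ.+ lam ℤ.* t) (pos-* k k))) (pos-* r k)))

2≤r : ∀ {v r k lam} → 0 < lam → 0 < k → k < v → r * k + lam ≡ lam * v + r → 2 ≤ r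
2≤r {v} {r} {k} {lam@(suc _)} _ 0<k k<v pair-count = r+k≤r*k⇒2≤r (+-cancelʳ-≤ lam (r + k) (r * k) (begin
  r + k + lam      ≡⟨ +-assoc r k lam ⟩
  r + (k + lam)    ≤⟨ +-monoʳ-≤ r k+lam≤lam*v ⟩
  r + lam * v      ≡⟨ +-comm r (lam * v) ⟩
  lam * v + r      ≡⟨ pair-count ⟨
  r * k + lam      ∎))
  where
  open ≤-Reasoning
  k+lam≤lam*v : k + lam ≤ lam * v
  k+lam≤lam*v = begin
    k + lam          ≡⟨ +-comm k lam ⟩
    lam + k          ≤⟨ +-monoʳ-≤ lam (m≤n*m k lam) ⟩
    lam + lam * k    ≡⟨ *-suc lam k ⟨
    lam * suc k      ≤⟨ *-monoʳ-≤ lam k<v ⟩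
    lam * v          ∎
  r+k≤r*k⇒2≤r : ∀ {r} → r + k ≤ r * k → 2 ≤ r
  r+k≤r*k⇒2≤r {0}           k≤0    = contradiction k≤0 (<⇒≱ 0<k)
  r+k≤r*k⇒2≤r {1}           1+k≤k = contradiction (≤-trans 1+k≤k (≤-reflexive (+-identityʳ k))) (1+n≰n)
  r+k≤r*k⇒2≤r {suc (suc r)} _      = s≤s (s≤s z≤n)

intersection-moments⇒k<r : ∀ {v n r k lam S₁ S₂} → 0 < lam → 0 < k → k < v →
  k + n * k ≡ v * r → r * k + lam ≡ lam * v + r →
  k + S₁ ≡ r * k → k * k + lam * k + S₂ ≡ lam * (k * k) + r * k →
  S₁ * S₁ + S₂ ≤ n * S₂ → k < r
intersection-moments⇒k<r {v} {n} {r} {k} {lam} {S₁} {S₂} 0<lam 0<k k<v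
  double-count pair-count moment₁ moment₂ cauchy-schwarz-bound with r ≤? k
... | no r≰k = ≰⇒> r≰k
... | yes r≤k with d , refl ← m≤n⇒∃[o]m+o≡n r≤k | e , refl ← m≤n⇒∃[o]m+o≡n k<v =
  contradiction (begin-strict
    kw * (S₁ * S₁)                             ≡⟨ +-identityʳ _ ⟨
    kw * (S₁ * S₁) + 0                         <⟨ +-monoʳ-< (kw * (S₁ * S₁)) 0<kw*S₂ ⟩
    kw * (S₁ * S₁) + kw * S₂                   ≡⟨ *-distribˡ-+ kw (S₁ * S₁) S₂ ⟨
    kw * (S₁ * S₁ + S₂)                        ≤⟨ *-monoʳ-≤ kw cauchy-schwarz-bound ⟩
    kw * (n * S₂)                              ≤⟨ m≤m+n _ _ ⟩
    kw * (n * S₂) + k * r * d * (suc e * suc e)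
      ≡⟨ fisher-defect-ℕ {r} {d} {e} {n} double-count pair-count moment₁ moment₂ ⟩
    kw * (S₁ * S₁)                             ∎) (<-irrefl refl)
  where
  open ≤-Reasoning
  kw : ℕ
  kw = k * (k + e)
  k≤S₁ : k ≤ S₁
  k≤S₁ = +-cancelˡ-≤ k k S₁ (begin
    k + k        ≡⟨ cong (k +_) (+-identityʳ k) ⟨
    2 * k        ≤⟨ *-monoˡ-≤ k (2≤r 0<lam 0<k k<v pair-count) ⟩
    r * k        ≡⟨ moment₁ ⟨
    k + S₁       ∎)
  0<S₂ : 0 < S₂
  0<S₂ = *-cancelˡ-< n 0 S₂ (begin-strict
    n * 0            ≡⟨ *-zeroʳ n ⟩
    0                <⟨ *-mono-≤ (≤-trans 0<k k≤S₁) (≤-trans 0<k k≤S₁) ⟩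
    S₁ * S₁          ≤⟨ m≤m+n (S₁ * S₁) S₂ ⟩
    S₁ * S₁ + S₂     ≤⟨ cauchy-schwarz-bound ⟩
    n * S₂           ∎)
  0<kw*S₂ : 0 < kw * S₂
  0<kw*S₂ = *-mono-≤ (*-mono-≤ 0<k (≤-trans 0<k (m≤m+n k e))) 0<S₂

disjoint-blocks⇒k<r : ∀ {v b r k lam} {B : Blocks v b} → IsDesign v b r k lam B → k < v →
  ∀ {i j} → Nonempty (B i) → Empty (B i ∩ B j) → k < r
disjoint-blocks⇒k<r {v} {suc n} {r} {k} {lam} {B} D k<v {i} {j} (y , y∈Bi) Bi∩Bj=∅ =
  intersection-moments⇒k<r {n = n} lam-pos 0<k k<v b*k≡v*r pair-count moment₁ moment₂
    (cauchy-schwarz-with-zero (removeAt x i) (punchOut i≢j) (trans (cong x (punchIn-punchOut i≢j)) x-j))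
  where
  open IsDesign D using (lam-pos)
  open DesignCounting D
  open ≡-Reasoning
  χ : Fin v → ℕ
  χ = incidence B i
  x : Fin (suc n) → ℕ
  x = weight χ
  S₁ S₂ : ℕ
  S₁ = sum (removeAt x i)
  S₂ = ∑[ C < n ] (removeAt x i C * removeAt x i C)

  0<k : 0 < k
  0<k = ≤-trans (≤-reflexive (cong indicator (sym ([]=⇒lookup y∈Bi))))
          (≤-trans (term≤sum χ y) (≤-reflexive (row-sum i)))
  i≢j : i ≢ j
  i≢j refl = Bi∩Bj=∅ (y , x∈p∩q⁺ (y∈Bi , y∈Bi))

  x-i : x i ≡ k
  x-i = trans (sum-cong-≗ (λ z → indicator-idem (lookup (B i) z))) (row-sum i)
  x-j : x j ≡ 0
  x-j = trans (sum-cong-≗ meet) (sum-replicate-zero v)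
    where
    meet : ∀ z → χ z * incidence B j z ≡ 0
    meet z = begin
      χ z * incidence B j z                          ≡⟨ indicator-∧ (lookup (B i) z) (lookup (B j) z) ⟨
      indicator (lookup (B i) z ∧ lookup (B j) z)   ≡⟨ cong indicator (lookup-zipWith _∧_ z (B i) (B j)) ⟨
      indicator (lookup (B i ∩ B j) z)              ≡⟨ Empty⇒indicator≡0 Bi∩Bj=∅ z ⟩
      0                                             ∎

  ∑x≡r*k : sum x ≡ r * k
  ∑x≡r*k = trans (first-moment χ) (cong (r *_) (row-sum i))

  moment₁ : k + S₁ ≡ r * k
  moment₁ = begin
    k + S₁         ≡⟨ cong (_+ S₁) x-i ⟨
    x i + S₁       ≡⟨ sum-remove x ⟨
    sum x          ≡⟨ ∑x≡r*k ⟩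
    r * k          ∎

  moment₂ : k * k + lam * k + S₂ ≡ lam * (k * k) + r * k
  moment₂ = begin
    k * k + lam * k + S₂                      ≡⟨ xy∙z≈xz∙y (k * k) (lam * k) S₂ ⟩
    k * k + S₂ + lam * k                      ≡⟨ cong₂ (λ a c → a + S₂ + lam * c) (cong₂ _*_ x-i x-i) x-i ⟨
    x i * x i + S₂ + lam * x i                ≡⟨ cong (_+ lam * x i) (sum-remove (λ C → x C * x C)) ⟨
    ∑[ C < suc n ] (x C * x C) + lam * x i    ≡⟨ second-moment χ χ ⟩
    lam * (sum χ * sum χ) + r * x i           ≡⟨ cong₂ (λ a c → lam * (a * a) + r * c) (row-sum i) x-i ⟩
    lam * (k * k) + r * k                     ∎

  pair-count : r * k + lam ≡ lam * v + r
  pair-count = *-cancelʳ-≡ (r * k + lam) (lam * v + r) k {{>-nonZero 0<k}} (begin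
    (r * k + lam) * k                                   ≡⟨ *-distribʳ-+ k (r * k) lam ⟩
    r * k * k + lam * k                                 ≡⟨ cong₂ (λ a c → a * k + lam * c) ∑x≡r*k ∑χ≡k ⟨
    sum x * k + lam * ∑[ z < v ] (χ z * 1)              ≡⟨ cong (_+ lam * ∑[ z < v ] (χ z * 1)) (*-distribʳ-sum k x) ⟩
    ∑[ C < suc n ] (x C * k) + lam * ∑[ z < v ] (χ z * 1)
      ≡⟨ cong (_+ lam * ∑[ z < v ] (χ z * 1)) (sum-cong-≗ (λ C → cong (x C *_) (weight-1 C))) ⟨
    ∑[ C < suc n ] (x C * weight (λ _ → 1) C) + lam * ∑[ z < v ] (χ z * 1)
      ≡⟨ second-moment χ (λ _ → 1) ⟩
    lam * (sum χ * ∑[ z < v ] 1) + r * ∑[ z < v ] (χ z * 1)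
      ≡⟨ cong₂ (λ a c → lam * (a * c) + r * ∑[ z < v ] (χ z * 1))
               (row-sum i) (trans (sum-const v 1) (*-identityʳ v)) ⟩
    lam * (k * v) + r * ∑[ z < v ] (χ z * 1)            ≡⟨ cong (λ a → lam * (k * v) + r * a) ∑χ≡k ⟩
    lam * (k * v) + r * k                               ≡⟨ regroup lam k v r ⟩
    (lam * v + r) * k                                   ∎)
    where
    ∑χ≡k : ∑[ z < v ] (χ z * 1) ≡ k
    ∑χ≡k = trans (sum-cong-≗ (λ z → *-identityʳ (χ z))) (row-sum i)
    weight-1 : ∀ C → weight (λ _ → 1) C ≡ k
    weight-1 C = trans (sum-cong-≗ (λ z → *-identityˡ (incidence B C z))) (row-sum C)
    regroup : ∀ lam k v r → lam * (k * v) + r * k ≡ (lam * v + r) * k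
    regroup = solve-∀

module _ {v b} {B : Blocks v b} where

  one-edge : ∀ {p q} → Adj B p q → DistLe (Adj B) 2 p q
  one-edge e = 1 , s≤s z≤n , step e here

  two-edges : ∀ {p q s} → Adj B p q → Adj B q s → DistLe (Adj B) 2 p s
  two-edges e f = 2 , s≤s (s≤s z≤n) , step e (step f here)

  walk⇒nonempty⊎≡ : ∀ {i u m} → DistLe (Adj B) m (inj₂ i) u → Nonempty (B i) ⊎ inj₂ i ≡ u
  walk⇒nonempty⊎≡ (_ , _ , here)               = inj₂ refl
  walk⇒nonempty⊎≡ (_ , _ , step (bp x∈Bi) _) = inj₁ (_ , x∈Bi)

  block-reaching-point-is-nonempty : ∀ {i x m} → DistLe (Adj B) m (inj₂ i) (inj₁ x) → Nonempty (B i)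
  block-reaching-point-is-nonempty d with walk⇒nonempty⊎≡ d
  ... | inj₁ Bi≠∅ = Bi≠∅

  far-pair⇒disjoint-blocks : (∀ p q → DistLe (Adj B) 3 p q) → ∀ p q → ¬ DistLe (Adj B) 2 p q →
    ∃[ i ] ∃[ j ] Nonempty (B i) × Empty (B i ∩ B j)
  far-pair⇒disjoint-blocks reach (inj₁ x) (inj₁ y) far with x Fin.≟ y
  ... | yes refl = contradiction (0 , z≤n , here) far
  ... | no x≢y   = contradiction (one-edge (pp x≢y)) far
  far-pair⇒disjoint-blocks reach (inj₁ x) (inj₂ i) far with block-reaching-point-is-nonempty (reach (inj₂ i) (inj₁ x))
  ... | y , y∈Bi with x Fin.≟ y
  ...   | yes refl = contradiction (one-edge (pb y∈Bi)) far
  ...   | no x≢y   = contradiction (two-edges (pp x≢y) (pb y∈Bi)) far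
  far-pair⇒disjoint-blocks reach (inj₂ i) (inj₁ x) far with block-reaching-point-is-nonempty (reach (inj₂ i) (inj₁ x))
  ... | y , y∈Bi with y Fin.≟ x
  ...   | yes refl = contradiction (one-edge (bp y∈Bi)) far
  ...   | no y≢x   = contradiction (two-edges (bp y∈Bi) (pp y≢x)) far
  far-pair⇒disjoint-blocks reach (inj₂ i) (inj₂ j) far with nonempty? (B i ∩ B j)
  ... | yes (z , z∈Bi∩Bj) =
    let z∈Bi , z∈Bj = x∈p∩q⁻ (B i) (B j) z∈Bi∩Bj in contradiction (two-edges (bp z∈Bi) (pb z∈Bj)) far
  ... | no Bi∩Bj=∅ with walk⇒nonempty⊎≡ (reach (inj₂ i) (inj₂ j))
  ...   | inj₁ Bi≠∅ = i , j , Bi≠∅ , Bi∩Bj=∅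
  ...   | inj₂ refl = contradiction (0 , z≤n , here) far

lemma2p5 : ∀ (v b r k lam : ℕ) (B : Blocks v b) → IsDesign v b r k lam B →
    k < v → HasDiameter (Adj B) 3 → (b ≢ v) × (v < b)
lemma2p5 v b r k lam B D k<v (reach , p , q , far)
  with i , j , Bi≠∅ , Bi∩Bj=∅ ← far-pair⇒disjoint-blocks reach p q far = >⇒≢ v<b , v<b
  where
  open DesignCounting D using (b*k≡v*r)
  open ≤-Reasoning
  k<r : k < r
  k<r = disjoint-blocks⇒k<r D k<v Bi≠∅ Bi∩Bj=∅
  v<b : v < b
  v<b = *-cancelʳ-< k v b (begin-strict
    v * k   <⟨ *-monoʳ-< v {{>-nonZero (≤-<-trans z≤n k<v)}} k<r ⟩
    v * r   ≡⟨ b*k≡v*r ⟨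
    b * k   ∎)
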